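{- Let $\mathcal{A}=\langle Q,\iota,\Sigma,\delta,\alpha\rangle$ be a nondeterministic Büchi automaton, $k=2(|Q|-|\alpha|)$, $\sigma\in\Sigma$, and let $s',o'\in Q_k$ be such that $f_{s'}\le f_{o'}$. Define $f_o:Q\to\mathbb{N}\cup\{\infty\}$ by: for $\ell\in Q$, $f_o(\ell)=\max\big(\{0\}\cup\{h(\ell')\mid \ell'\in\delta(\ell,\sigma)\}\big)$, where $h(\ell')=f_{o'}(\ell')$ if $\ell'\in\alpha$ and $h(\ell')=\min\{f_{o'}(\ell'),\lceil f_{s'}(\ell')\rceil_{odd}\}$ if $\ell'\notin\alpha$; and then, if $\ell\in\alpha$, replace $f_o(\ell)$ by $\lceil f_o(\ell)\rceil_{even}$. Let $L_{\mathsf{Pre}}=\{\langle f_o,f_\emptyset\rangle\}$. If there is $\ell$ with $f_o(\ell)\le k$, define $f_s(\ell)=\max\{f_{s'}(\ell')\mid\ell'\in\delta(\ell,\sigma)\}$ for $\ell\in Q$ (replaced by $\lceil f_s(\ell)\rceil_{even}$ when $\ell\in\alpha$), and add $\langle f_s,f_o\rangle$ to $L_{\mathsf{Pre}}$. Then $[\![L_{\mathsf{Pre}}]\!]=\mathsf{Pre}^{{\sf KVMH}(\mathcal{A})}_\sigma([\![\langle f_{s'},f_{o'}\rangle]\!])$, and for every $\langle f_1,f_2\rangle\in L_{\mathsf{Pre}}$ we have $f_1\le f_2$ and $f_1(\ell)$, $f_2(\ell)$ are even for all $\ell\in\alpha$.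
   Context: An NBW is $\mathcal{A}=\langle Q,\iota,\Sigma,\delta,\alpha\rangle$ with finite state set $Q$, initial state $\iota$, finite alphabet $\Sigma$, $\delta:Q\times\Sigma\to 2^Q$, accepting set $\alpha\subseteq Q$. Let $[k]=\{0,\dots,k\}$, $Q_k=2^{(Q\times[k])\setminus(\alpha\times\mathbb{N}^{odd})}$ ($\mathbb{N}^{odd}$ the odd naturals), $\mathsf{odd}=Q\times[k]^{odd}$. ${\sf KVMH}(\mathcal{A})$ is the NBW with states $Q_k\times Q_k$, initial state $(\{(\iota,k)\},\emptyset)$, accepting states $Q_k\times\{\emptyset\}$, and transitions: if $o\neq\emptyset$, $\delta'(\langle s,o\rangle,\sigma)$ is the set of pairs $\langle s_2,o_2\setminus\mathsf{odd}\rangle$ ($s_2,o_2\in Q_k$) with (i) $o_2\subseteq s_2$; (ii) for all $(\ell,n)\in s$, $\ell'\in\delta(\ell,\sigma)$ there is $n'\le n$ with $(\ell',n')\in s_2$; (iii) for all $(\ell,n)\in o$, $\ell'\in\delta(\ell,\sigma)$ there is $n'\le n$ with $(\ell',n')\in o_2$; if $o=\emptyset$, it is the set of pairs $\langle s_2,s_2\setminus\mathsf{odd}\rangle$ satisfying (ii). For a set $L$ of states, $\mathsf{Pre}^{{\sf KVMH}(\mathcal{A})}_\sigma(L)=\{x\mid\exists y\in L: y\in\delta'(x,\sigma)\}$. For $s\in Q_k$, $f_s(\ell)=\inf\{n\mid(\ell,n)\in s\}$ with $\inf\emptyset=\infty$; $f_\emptyset$ is the constant $\infty$ function; $\infty$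 is treated as larger than every natural number, with $\lceil\infty\rceil_{odd}=\lceil\infty\rceil_{even}=\infty$; $\lceil n\rceil_{odd}$ (resp. $\lceil n\rceil_{even}$) is the least odd (resp. even) number $\ge n$, and $\max\emptyset=0$. For $f,f':Q\to\mathbb{N}\cup\{\infty\}$, $f\le f'$ iff for all $\ell$, $f(\ell)\le f'(\ell)$ or $f'(\ell)>k$. For pairs, $\langle f,g\rangle\le\langle f',g'\rangle$ iff $f\le f'$, $g\le g'$, and ($g=f_\emptyset$ iff $g'=f_\emptyset$). $[\![\langle f,g\rangle]\!]=\{\langle s,o\rangle\in Q_k\times Q_k\mid\langle f,g\rangle\le\langle f_s,f_o\rangle\}$, and $[\![L]\!]=\bigcup_{p\in L}[\![p]\!]$ for a set $L$ of pairs. -}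

module Defs where

open import Data.Bool using (Bool; true; false; if_then_else_)
open import Data.Nat using (ℕ; zero; suc; _≤_; _<_; _∸_; _*_)
open import Data.Nat.Properties using (_≤?_)
open import Data.Nat.Divisibility using (_∣_; _∣?_)
open import Data.Fin using (Fin; toℕ) renaming (zero to fzero; suc to fsuc)
open import Data.Fin.Subset using (Subset; _∈_; ∣_∣)
open import Data.Fin.Properties using (any?)
open import Data.Vec using (Vec; []; _∷_; lookup)
open import Data.List using (List; []; _∷_)
open import Data.List.Relation.Unary.Any using (Any)
open import Data.Product using (Σ; ∃; _×_; _,_; proj₁; proj₂)
open import Data.Sum using (_⊎_)
open import Data.Unit using (⊤)
open import Data.Empty using (⊥)
open import Relation.Nullary using (¬_; Dec; yes; no; does)
open import Relation.Binary.PropositionalEquality using (_≡_)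

record NBW (n m : ℕ) : Set where
  field
    ι : Fin n
    δ : Fin n → Fin m → Subset n
    α : Subset n
open NBW public

K : ∀ {n m} → NBW n m → ℕ
K {n} A = 2 * (n ∸ ∣ α A ∣)

data ℕ∞ : Set where
  fin : ℕ → ℕ∞
  ∞   : ℕ∞

suc∞ : ℕ∞ → ℕ∞
suc∞ (fin a) = fin (suc a)
suc∞ ∞ = ∞

_≤∞_ : ℕ∞ → ℕ∞ → Set
fin a ≤∞ fin b = a ≤ b
fin a ≤∞ ∞ = ⊤
∞ ≤∞ fin b = ⊥
∞ ≤∞ ∞ = ⊤

_≤∞?_ : (x y : ℕ∞) → Dec (x ≤∞ y)
fin a ≤∞? fin b = a ≤? b
fin a ≤∞? ∞ = yes _
∞ ≤∞? fin b = no (λ ())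
∞ ≤∞? ∞ = yes _

_>K_ : ℕ∞ → ℕ → Set
fin a >K k = k < a
∞ >K k = ⊤

max∞ : ℕ∞ → ℕ∞ → ℕ∞
max∞ (fin a) (fin b) = fin (Data.Nat._⊔_ a b)
max∞ _ _ = ∞

min∞ : ℕ∞ → ℕ∞ → ℕ∞
min∞ (fin a) (fin b) = fin (Data.Nat._⊓_ a b)
min∞ (fin a) ∞ = fin a
min∞ ∞ y = y

Even : ℕ → Set
Even a = 2 ∣ a

Odd : ℕ → Set
Odd a = ¬ (2 ∣ a)

-- ∞ is counted as even (consistent with ⌈∞⌉_even = ∞)
Even∞ : ℕ∞ → Set
Even∞ (fin a) = Even a
Even∞ ∞ = ⊤

⌈_⌉odd : ℕ∞ → ℕ∞
⌈ fin a ⌉odd = if does (2 ∣? a) then fin (suc a) else fin a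
⌈ ∞ ⌉odd = ∞

⌈_⌉even : ℕ∞ → ℕ∞
⌈ fin a ⌉even = if does (2 ∣? a) then fin a else fin (suc a)
⌈ ∞ ⌉even = ∞

-- Q_k = 2^((Q × [k]) \ (α × odd)), [k] = Fin (suc k)
RawSet : ℕ → ℕ → Set
RawSet n k = Fin n → Fin (suc k) → Bool

Qk : (n k : ℕ) → Subset n → Set
Qk n k α = Σ (RawSet n k) λ s →
  ∀ ℓ j → ℓ ∈ α → Odd (toℕ j) → s ℓ j ≡ false

minTrue : ∀ {k} → (Fin k → Bool) → ℕ∞
minTrue {zero} p = ∞
minTrue {suc k} p = if p fzero then fin 0 else suc∞ (minTrue (λ j → p (fsuc j)))

Fn : ℕ → Set
Fn n = Fin n → ℕ∞

fOf : ∀ {n k α} → Qk n k α → Fn n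
fOf (s , _) ℓ = minTrue (s ℓ)

f∅ : ∀ {n} → Fn n
f∅ _ = ∞

IsF∅ : ∀ {n} → Fn n → Set
IsF∅ g = ∀ ℓ → g ℓ ≡ ∞

FnLe : ∀ {n} → ℕ → Fn n → Fn n → Set
FnLe k f f' = ∀ ℓ → (f ℓ ≤∞ f' ℓ) ⊎ (f' ℓ >K k)

Pair : ℕ → Set
Pair n = Fn n × Fn n

PairLe : ∀ {n} → ℕ → Pair n → Pair n → Set
PairLe k (f , g) (f' , g') =
  FnLe k f f' × FnLe k g g' × ((IsF∅ g → IsF∅ g') × (IsF∅ g' → IsF∅ g))

KState : ∀ {n m} → NBW n m → Set
KState {n} A = Qk n (K A) (α A) × Qk n (K A) (α A)

⟦_⟧ : ∀ {n m} {A : NBW n m} → Pair n → KState A → Set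
⟦_⟧ {A = A} p (s , o) = PairLe (K A) p (fOf s , fOf o)

⟦_⟧L : ∀ {n m} {A : NBW n m} → List (Pair n) → KState A → Set
⟦_⟧L {A = A} L x = Any (λ p → ⟦_⟧ {A = A} p x) L

module _ {n m} (A : NBW n m) (σ : Fin m) where
  private k = K A

  IsEmptyR : RawSet n k → Set
  IsEmptyR o = ∀ ℓ j → o ℓ j ≡ false

  Covers : RawSet n k → RawSet n k → Set
  Covers s s₂ = ∀ ℓ j → s ℓ j ≡ true → ∀ ℓ' → ℓ' ∈ δ A ℓ σ →
    ∃ λ j' → toℕ j' ≤ toℕ j × s₂ ℓ' j' ≡ true

  SubsetR : RawSet n k → RawSet n k → Set
  SubsetR o s = ∀ ℓ j → o ℓ j ≡ true → s ℓ j ≡ true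

  MinusOdd : RawSet n k → RawSet n k → Set
  MinusOdd o₂ o₃ = ∀ ℓ j →
    ((o₃ ℓ j ≡ true) → (o₂ ℓ j ≡ true × ¬ Odd (toℕ j))) ×
    ((o₂ ℓ j ≡ true × ¬ Odd (toℕ j)) → (o₃ ℓ j ≡ true))

  Step : KState A → KState A → Set
  Step ((s , _) , (o , _)) ((s₃ , _) , (o₃ , _)) =
    (¬ IsEmptyR o × Σ (Qk n k (α A)) λ o₂ →
        SubsetR (proj₁ o₂) s₃ × Covers s s₃ × Covers o (proj₁ o₂) × MinusOdd (proj₁ o₂) o₃)
    ⊎ (IsEmptyR o × Covers s s₃ × MinusOdd s₃ o₃)

  Pre : (KState A → Set) → KState A → Set
  Pre L x = Σ (KState A) λ y → L y × Step x y

maxOver : ∀ {n} → Subset n → Fn n → ℕ∞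
maxOver [] g = fin 0
maxOver (true ∷ S) g = max∞ (g fzero) (maxOver S (λ i → g (fsuc i)))
maxOver (false ∷ S) g = maxOver S (λ i → g (fsuc i))

module _ {n m} (A : NBW n m) (σ : Fin m) (fs' fo' : Fn n) where
  h : Fn n
  h ℓ' = if lookup (α A) ℓ' then fo' ℓ' else min∞ (fo' ℓ') ⌈ fs' ℓ' ⌉odd

  fo : Fn n
  fo ℓ = if lookup (α A) ℓ then ⌈ maxOver (δ A ℓ σ) h ⌉even else maxOver (δ A ℓ σ) h

  fs : Fn n
  fs ℓ = if lookup (α A) ℓ then ⌈ maxOver (δ A ℓ σ) fs' ⌉even else maxOver (δ A ℓ σ) fs'

  LPre : List (Pair n)
  LPre with any? (λ ℓ → fo ℓ ≤∞? fin (K A))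
  ... | yes _ = (fo , f∅) ∷ (fs , fo) ∷ []
  ... | no _ = (fo , f∅) ∷ []

KStateComp : ∀ {n m} → NBW n m → Set
KStateComp {n} A = Qk n (K A) (α A)

module Submission where

-- Rank sets are handled through their rank functions: ⟨f⟩ ≤ f_s says that
-- every rank occurring in s dominates f (FnLe⇒Below, Below⇒FnLe), and
-- f_s = f_∅ says that s is vacant.  Both components of L_Pre have the shape
-- lift g ℓ = max_{ℓ'∈δ(ℓ,σ)} g ℓ' (rounded up to even on α), and in module
-- Successors lift g bounds s from below exactly when the σ-successors of s
-- are covered by a set bounded by g.  Module Predecessor fixes s', o' and
-- builds the largest successor sets compatible with ⟨f_{s'},f_{o'}⟩: S⁺, its
-- subset O₂⁺, and O₃⁺ = O₂⁺ ∖ odd (via Tabulate); h is exactly the least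
-- rank an O₂-like set may use (H-below, O₂-reach).  Soundness takes these
-- canonical sets as the successor; completeness reads the bounds off an
-- arbitrary successor.  The order and parity invariants of L_Pre follow from
-- monotonicity of lift and even rounding.

open import Defs
open import Data.Bool using (Bool; true; false; if_then_else_; _≟_)
open import Data.Nat using (ℕ; zero; suc; _≤_; z≤n; s≤s; _∸_)
open import Data.Nat.Properties
  using (≤-refl; ≤-trans; n≤1+n; <⇒≱; <-≤-trans; ≤∧≢⇒<; ⊔-lub; m⊔n≤o⇒m≤o; m⊔n≤o⇒n≤o;
         m⊓n≤m; m⊓n≤n; ⊓-sel; +-comm; *-comm)
open import Data.Nat.Divisibility using (_∣_; _∣?_; divides; ∣m+n∣m⇒∣n; ∣1⇒≡1)
open import Data.Fin using (Fin; toℕ; fromℕ; fromℕ<) renaming (zero to fzero; suc to fsuc)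
open import Data.Fin.Properties using (any?; toℕ-fromℕ; toℕ-fromℕ<; toℕ≤pred[n])
open import Data.Fin.Subset using (Subset; _∈_; _∉_; ∣_∣)
open import Data.Fin.Subset.Properties using (_∈?_)
open import Data.Vec using ([]; _∷_; here; there; lookup)
open import Data.Vec.Properties using ([]=⇒lookup; lookup⇒[]=)
open import Data.List.Relation.Unary.Any using (Any; here; there)
open import Data.List.Relation.Unary.All using (All; []; _∷_)
open import Data.Product using (∃; ∃₂; _×_; _,_; proj₁; proj₂)
open import Data.Sum using (_⊎_; inj₁; inj₂; [_,_]′)
open import Data.Unit using (tt)
open import Data.Empty using (⊥-elim)
open import Relation.Nullary using (¬_; Dec; yes; no; does; contradiction)
open import Relation.Nullary.Decidable using (dec-true; dec-false; _×-dec_; _→-dec_; ¬?)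
open import Relation.Binary.PropositionalEquality using (_≡_; refl; sym; trans; cong; subst)
open import Function.Bundles using (_⇔_; mk⇔; Equivalence)
open import Function.Base using (_∘_)

≤∞-refl : ∀ x → x ≤∞ x
≤∞-refl (fin a) = ≤-refl
≤∞-refl ∞ = tt

≤∞-trans : ∀ {x y z} → x ≤∞ y → y ≤∞ z → x ≤∞ z
≤∞-trans {fin a} {fin b} {fin c} p q = ≤-trans p q
≤∞-trans {fin a} {fin b} {∞} p q = tt
≤∞-trans {fin a} {∞} {∞} p q = tt
≤∞-trans {∞} {∞} {∞} p q = tt

≤∞-top : ∀ x → x ≤∞ ∞
≤∞-top (fin a) = tt
≤∞-top ∞ = tt

0≤∞ : ∀ x → fin 0 ≤∞ x
0≤∞ (fin a) = z≤n
0≤∞ ∞ = tt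

>K-up : ∀ {k x y} → x ≤∞ y → x >K k → y >K k
>K-up {x = fin a} {fin b} a≤b k<a = <-≤-trans k<a a≤b
>K-up {x = fin a} {∞} _ _ = tt
>K-up {x = ∞} {∞} _ _ = tt

_≤[_]_ : ℕ∞ → ℕ → ℕ∞ → Set
x ≤[ k ] y = (x ≤∞ y) ⊎ (y >K k)

-- Below a legal rank b ≤ k the escape clause cannot apply.
≤[]-below-rank : ∀ {k x y b} → x ≤[ k ] y → y ≤∞ fin b → b ≤ k → x ≤∞ fin b
≤[]-below-rank {x = x} (inj₁ x≤y) y≤b _ = ≤∞-trans {x} x≤y y≤b
≤[]-below-rank {y = fin c} (inj₂ k<c) c≤b b≤k = ⊥-elim (<⇒≱ k<c (≤-trans c≤b b≤k))

-- Parity.  Hypotheses "c is even" are stated as ¬ Odd c, the form in which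
-- evenness arises from Q_k and from MinusOdd.

even-or-even-suc : ∀ a → Even a ⊎ Even (suc a)
even-or-even-suc zero = inj₁ (divides 0 refl)
even-or-even-suc (suc a) with even-or-even-suc a
... | inj₁ (divides q eq) = inj₂ (divides (suc q) (cong (λ x → suc (suc x)) eq))
... | inj₂ e = inj₁ e

even⇒odd-suc : ∀ {a} → Even a → Odd (suc a)
even⇒odd-suc {a} e e' with ∣1⇒≡1 (∣m+n∣m⇒∣n (subst (2 ∣_) (+-comm 1 a) e') e)
... | ()

odd⇒even-suc : ∀ {a} → Odd a → Even (suc a)
odd⇒even-suc {a} o with even-or-even-suc a
... | inj₁ e = ⊥-elim (o e)
... | inj₂ e = e

if-does : ∀ {P A : Set} (d : Dec P) (t e : A) →
  (P × (if does d then t else e) ≡ t) ⊎ (¬ P × (if does d then t else e) ≡ e)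
if-does (yes p) t e = inj₁ (p , refl)
if-does (no ¬p) t e = inj₂ (¬p , refl)

⌈⌉even-cases : ∀ a → (Even a × ⌈ fin a ⌉even ≡ fin a) ⊎ (Odd a × ⌈ fin a ⌉even ≡ fin (suc a))
⌈⌉even-cases a = if-does (2 ∣? a) _ _

⌈⌉odd-cases : ∀ a → (Even a × ⌈ fin a ⌉odd ≡ fin (suc a)) ⊎ (Odd a × ⌈ fin a ⌉odd ≡ fin a)
⌈⌉odd-cases a = if-does (2 ∣? a) _ _

⌈⌉even-≥ : ∀ x → x ≤∞ ⌈ x ⌉even
⌈⌉even-≥ ∞ = tt
⌈⌉even-≥ (fin a) with ⌈⌉even-cases a
... | inj₁ (_ , eq) rewrite eq = ≤-refl
... | inj₂ (_ , eq) rewrite eq = n≤1+n a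

⌈⌉even-even : ∀ x → Even∞ ⌈ x ⌉even
⌈⌉even-even ∞ = tt
⌈⌉even-even (fin a) with ⌈⌉even-cases a
... | inj₁ (e , eq) rewrite eq = e
... | inj₂ (o , eq) rewrite eq = odd⇒even-suc o

⌈⌉even-least : ∀ x z → (∀ c → z ≡ fin c → ¬ Odd c) → x ≤∞ z → ⌈ x ⌉even ≤∞ z
⌈⌉even-least x ∞ _ _ = ≤∞-top ⌈ x ⌉even
⌈⌉even-least (fin a) (fin c) ev a≤c with ⌈⌉even-cases a
... | inj₁ (_ , eq) rewrite eq = a≤c
... | inj₂ (o , eq) rewrite eq = ≤∧≢⇒< a≤c (λ { refl → ev c refl o })

⌈⌉even-mono : ∀ x y → x ≤∞ y → ⌈ x ⌉even ≤∞ ⌈ y ⌉even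
⌈⌉even-mono x y x≤y = ⌈⌉even-least x ⌈ y ⌉even even-value (≤∞-trans {x} x≤y (⌈⌉even-≥ y))
  where
  even-value : ∀ c → ⌈ y ⌉even ≡ fin c → ¬ Odd c
  even-value c eq odd = odd (subst Even∞ eq (⌈⌉even-even y))

⌈⌉odd-≥ : ∀ x → x ≤∞ ⌈ x ⌉odd
⌈⌉odd-≥ ∞ = tt
⌈⌉odd-≥ (fin a) with ⌈⌉odd-cases a
... | inj₁ (_ , eq) rewrite eq = n≤1+n a
... | inj₂ (_ , eq) rewrite eq = ≤-refl

⌈⌉odd-odd : ∀ x c → ⌈ x ⌉odd ≡ fin c → Odd c
⌈⌉odd-odd (fin a) c eq' with ⌈⌉odd-cases a
... | inj₁ (e , eq) rewrite eq with eq'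
...   | refl = even⇒odd-suc e
⌈⌉odd-odd (fin a) c eq' | inj₂ (o , eq) rewrite eq with eq'
...   | refl = o

⌈⌉odd-least : ∀ x c → Odd c → x ≤∞ fin c → ⌈ x ⌉odd ≤∞ fin c
⌈⌉odd-least (fin a) c oc a≤c with ⌈⌉odd-cases a
... | inj₁ (e , eq) rewrite eq = ≤∧≢⇒< a≤c (λ { refl → oc e })
... | inj₂ (_ , eq) rewrite eq = a≤c

min-sel : ∀ x y → (min∞ x y ≡ x) ⊎ (min∞ x y ≡ y)
min-sel (fin a) (fin b) = [ (λ eq → inj₁ (cong fin eq)) , (λ eq → inj₂ (cong fin eq)) ]′ (⊓-sel a b)
min-sel (fin a) ∞ = inj₁ refl
min-sel ∞ y = inj₂ refl

min-≤ˡ : ∀ x y → min∞ x y ≤∞ x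
min-≤ˡ (fin a) (fin b) = m⊓n≤m a b
min-≤ˡ (fin a) ∞ = ≤-refl
min-≤ˡ ∞ y = ≤∞-top y

min-≤ʳ : ∀ x y → min∞ x y ≤∞ y
min-≤ʳ (fin a) (fin b) = m⊓n≤n a b
min-≤ʳ (fin a) ∞ = tt
min-≤ʳ ∞ y = ≤∞-refl y

min-split : ∀ x y z → min∞ x y ≤∞ z → (x ≤∞ z) ⊎ (y ≤∞ z)
min-split x y z p with min-sel x y
... | inj₁ eq = inj₁ (subst (_≤∞ z) eq p)
... | inj₂ eq = inj₂ (subst (_≤∞ z) eq p)

min-≤[] : ∀ k x y z → x ≤[ k ] y → x ≤∞ z → x ≤[ k ] min∞ y z
min-≤[] k x y z x≤y x≤z with min-sel y z
... | inj₁ eq rewrite eq = x≤y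
... | inj₂ eq rewrite eq = inj₁ x≤z

max-lub : ∀ x y z → x ≤∞ z → y ≤∞ z → max∞ x y ≤∞ z
max-lub (fin a) (fin b) (fin c) p q = ⊔-lub p q
max-lub (fin a) (fin b) ∞ p q = tt
max-lub (fin a) ∞ ∞ p q = tt
max-lub ∞ y ∞ p q = tt

max-≤ : ∀ x y z → max∞ x y ≤∞ z → x ≤∞ z × y ≤∞ z
max-≤ x y ∞ _ = ≤∞-top x , ≤∞-top y
max-≤ (fin a) (fin b) (fin c) p = m⊔n≤o⇒m≤o a b p , m⊔n≤o⇒n≤o a b p

max-≤[] : ∀ k x y x' y' → x ≤[ k ] x' → y ≤[ k ] y' → max∞ x y ≤[ k ] max∞ x' y'
max-≤[] k x y x' y' (inj₂ k<x') _ = inj₂ (>K-up {k} (proj₁ (max-≤ x' y' _ (≤∞-refl _))) k<x')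
max-≤[] k x y x' y' _ (inj₂ k<y') = inj₂ (>K-up {k} (proj₂ (max-≤ x' y' _ (≤∞-refl _))) k<y')
max-≤[] k x y x' y' (inj₁ x≤x') (inj₁ y≤y') = inj₁ (max-lub x y _
  (≤∞-trans {x} x≤x' (proj₁ (max-≤ x' y' _ (≤∞-refl _))))
  (≤∞-trans {y} y≤y' (proj₂ (max-≤ x' y' _ (≤∞-refl _)))))

maxOver-lub : ∀ {n} (S : Subset n) (g : Fn n) z → (∀ i → i ∈ S → g i ≤∞ z) → maxOver S g ≤∞ z
maxOver-lub [] g z _ = 0≤∞ z
maxOver-lub (true ∷ S) g z bd =
  max-lub _ _ z (bd fzero here) (maxOver-lub S _ z (λ i i∈S → bd (fsuc i) (there i∈S)))
maxOver-lub (false ∷ S) g z bd = maxOver-lub S _ z (λ i i∈S → bd (fsuc i) (there i∈S))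

maxOver-ub : ∀ {n} (S : Subset n) (g : Fn n) z → maxOver S g ≤∞ z → ∀ i → i ∈ S → g i ≤∞ z
maxOver-ub (true ∷ S) g z p fzero here = proj₁ (max-≤ _ _ z p)
maxOver-ub (true ∷ S) g z p (fsuc i) (there i∈S) = maxOver-ub S _ z (proj₂ (max-≤ _ _ z p)) i i∈S
maxOver-ub (false ∷ S) g z p (fsuc i) (there i∈S) = maxOver-ub S _ z p i i∈S

maxOver-≤[] : ∀ {n} k (S : Subset n) (g g' : Fn n) →
  (∀ i → g i ≤[ k ] g' i) → maxOver S g ≤[ k ] maxOver S g'
maxOver-≤[] k [] g g' _ = inj₁ z≤n
maxOver-≤[] k (true ∷ S) g g' le =
  max-≤[] k _ _ _ _ (le fzero) (maxOver-≤[] k S _ _ (λ i → le (fsuc i)))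
maxOver-≤[] k (false ∷ S) g g' le = maxOver-≤[] k S _ _ (λ i → le (fsuc i))

data MinView {k} (p : Fin k → Bool) : ℕ∞ → Set where
  attained : ∀ i → p i ≡ true → (∀ j → p j ≡ true → toℕ i ≤ toℕ j) → MinView p (fin (toℕ i))
  none : (∀ i → p i ≡ false) → MinView p ∞

minView : ∀ {k} (p : Fin k → Bool) → MinView p (minTrue p)
minView {zero} p = none (λ ())
minView {suc k} p with p fzero in p0
... | true = attained fzero p0 (λ _ _ → z≤n)
... | false with minTrue (λ j → p (fsuc j)) | minView (λ j → p (fsuc j))
...   | .(fin (toℕ i)) | attained i pi least = attained (fsuc i) pi least′
  where
  least′ : ∀ j → p j ≡ true → suc (toℕ i) ≤ toℕ j
  least′ fzero pj = contradiction (trans (sym p0) pj) λ ()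
  least′ (fsuc j) pj = s≤s (least j pj)
...   | ∞ | none empty = none λ { fzero → p0 ; (fsuc j) → empty j }

Below : ∀ {n k} → Fn n → RawSet n k → Set
Below f s = ∀ ℓ j → s ℓ j ≡ true → f ℓ ≤∞ fin (toℕ j)

Vacant : ∀ {n k} → RawSet n k → Set
Vacant s = ∀ ℓ j → s ℓ j ≡ false

-- A set that is not vacant has a witness (the ranks of Q × [k] are finitely many).
occupied : ∀ {n k} (s : RawSet n k) → ¬ Vacant s → ∃₂ λ ℓ j → s ℓ j ≡ true
occupied s ¬vacant with any? (λ ℓ → any? (λ j → s ℓ j ≟ true))
... | yes witness = witness
... | no ¬witness = contradiction vacant ¬vacant
  where
  vacant : Vacant s
  vacant ℓ j with s ℓ j in sℓj
  ... | false = refl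
  ... | true = contradiction (ℓ , j , sℓj) ¬witness

as-rank : ∀ {k} b (j : Fin (suc k)) → b ≤ toℕ j → ∃ λ (j' : Fin (suc k)) → toℕ j' ≡ b
as-rank b j b≤j = fromℕ< (s≤s (≤-trans b≤j (toℕ≤pred[n] j))) , toℕ-fromℕ< _

module _ {n k : ℕ} {α : Subset n} where

  FnLe⇒Below : (s : Qk n k α) (f : Fn n) → FnLe k f (fOf s) → Below f (proj₁ s)
  FnLe⇒Below s f f≤s ℓ j sℓj with minTrue (proj₁ s ℓ) | minView (proj₁ s ℓ) | f≤s ℓ
  ... | _ | attained i _ least | le = ≤[]-below-rank le (least j sℓj) (toℕ≤pred[n] j)
  ... | _ | none empty | _ = contradiction (trans (sym (empty j)) sℓj) λ ()

  Below⇒FnLe : (s : Qk n k α) (f : Fn n) → Below f (proj₁ s) → FnLe k f (fOf s)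
  Below⇒FnLe s f below ℓ with minTrue (proj₁ s ℓ) | minView (proj₁ s ℓ)
  ... | _ | attained i sℓi _ = inj₁ (below ℓ i sℓi)
  ... | _ | none _ = inj₂ tt

  fOf-below : (s : Qk n k α) → Below (fOf s) (proj₁ s)
  fOf-below s = FnLe⇒Below s (fOf s) (λ ℓ → inj₁ (≤∞-refl (fOf s ℓ)))

  F∅⇒Vacant : (s : Qk n k α) → IsF∅ (fOf s) → Vacant (proj₁ s)
  F∅⇒Vacant s F∅ ℓ j with proj₁ s ℓ j in sℓj
  ... | false = refl
  ... | true with minTrue (proj₁ s ℓ) | minView (proj₁ s ℓ) | F∅ ℓ
  ...   | _ | attained _ _ _ | ()
  ...   | _ | none empty | _ = contradiction (trans (sym (empty j)) sℓj) λ ()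

  Vacant⇒F∅ : (s : Qk n k α) → Vacant (proj₁ s) → IsF∅ (fOf s)
  Vacant⇒F∅ s vacant ℓ with minTrue (proj₁ s ℓ) | minView (proj₁ s ℓ)
  ... | _ | attained i sℓi _ = contradiction (trans (sym sℓi) (vacant ℓ i)) λ ()
  ... | _ | none _ = refl

  Qk-even : (s : Qk n k α) → ∀ {ℓ j} → ℓ ∈ α → proj₁ s ℓ j ≡ true → ¬ Odd (toℕ j)
  Qk-even s {ℓ} {j} ℓ∈α sℓj odd = contradiction (trans (sym sℓj) (proj₂ s ℓ j ℓ∈α odd)) λ ()

  module Tabulate (P : Fin n → ℕ → Set) (P? : ∀ ℓ c → Dec (P ℓ c))
                  (no-odd-α : ∀ ℓ c → ℓ ∈ α → Odd c → ¬ P ℓ c) where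

    set : Qk n k α
    set = (λ ℓ j → does (P? ℓ (toℕ j)))
        , (λ ℓ j ℓ∈α odd → dec-false (P? ℓ (toℕ j)) (no-odd-α ℓ (toℕ j) ℓ∈α odd))

    member⁻ : ∀ ℓ j → proj₁ set ℓ j ≡ true → P ℓ (toℕ j)
    member⁻ ℓ j with P? ℓ (toℕ j)
    ... | yes p = λ _ → p

    member⁺ : ∀ ℓ j → P ℓ (toℕ j) → proj₁ set ℓ j ≡ true
    member⁺ ℓ j = dec-true (P? ℓ (toℕ j))

    reach : ∀ ℓ (j : Fin (suc k)) → (∃ λ b → b ≤ toℕ j × P ℓ b) →
      ∃ λ j' → toℕ j' ≤ toℕ j × proj₁ set ℓ j' ≡ true
    reach ℓ j (b , b≤j , p) with as-rank b j b≤j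
    ... | j' , refl = j' , b≤j , member⁺ ℓ j' p

module Successors {n m} (A : NBW n m) (σ : Fin m) where

  private
    k : ℕ
    k = K A

  lift : Fn n → Fn n
  lift g ℓ = if lookup (α A) ℓ then ⌈ maxOver (δ A ℓ σ) g ⌉even else maxOver (δ A ℓ σ) g

  max≤lift : ∀ g ℓ → maxOver (δ A ℓ σ) g ≤∞ lift g ℓ
  max≤lift g ℓ with lookup (α A) ℓ
  ... | true = ⌈⌉even-≥ (maxOver (δ A ℓ σ) g)
  ... | false = ≤∞-refl (maxOver (δ A ℓ σ) g)

  lift-≤⇒succ : ∀ g ℓ c → lift g ℓ ≤∞ fin c → ∀ ℓ' → ℓ' ∈ δ A ℓ σ → g ℓ' ≤∞ fin c
  lift-≤⇒succ g ℓ c p =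
    maxOver-ub (δ A ℓ σ) g (fin c) (≤∞-trans {maxOver (δ A ℓ σ) g} (max≤lift g ℓ) p)

  succ⇒lift-≤ : ∀ g ℓ c → (ℓ ∈ α A → ¬ Odd c) → (∀ ℓ' → ℓ' ∈ δ A ℓ σ → g ℓ' ≤∞ fin c) → lift g ℓ ≤∞ fin c
  succ⇒lift-≤ g ℓ c even bound with lookup (α A) ℓ in ℓα
  ... | true = ⌈⌉even-least _ (fin c) (λ { c refl → even (lookup⇒[]= ℓ (α A) ℓα) })
                 (maxOver-lub (δ A ℓ σ) g (fin c) bound)
  ... | false = maxOver-lub (δ A ℓ σ) g (fin c) bound

  lift-even : ∀ g ℓ → ℓ ∈ α A → Even∞ (lift g ℓ)
  lift-even g ℓ ℓ∈α rewrite []=⇒lookup ℓ∈α = ⌈⌉even-even (maxOver (δ A ℓ σ) g)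

  lift-≤[] : ∀ g g' → (∀ ℓ → g ℓ ≤[ k ] g' ℓ) → FnLe k (lift g) (lift g')
  lift-≤[] g g' le ℓ with lookup (α A) ℓ | maxOver-≤[] k (δ A ℓ σ) g g' le
  ... | false | max≤ = max≤
  ... | true | inj₁ max≤max' = inj₁ (⌈⌉even-mono _ _ max≤max')
  ... | true | inj₂ k<max' = inj₂ (>K-up {k} (⌈⌉even-≥ _) k<max')

  below-lift⇒covers : (s X : RawSet n k) (g : Fn n) →
    (∀ ℓ' (j : Fin (suc k)) → g ℓ' ≤∞ fin (toℕ j) → ∃ λ j' → toℕ j' ≤ toℕ j × X ℓ' j' ≡ true) →
    Below (lift g) s → Covers A σ s X
  below-lift⇒covers s X g reach below ℓ j sℓj ℓ' ℓ'∈δ =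
    reach ℓ' j (lift-≤⇒succ g ℓ (toℕ j) (below ℓ j sℓj) ℓ' ℓ'∈δ)

  covers⇒below-lift : (s : Qk n k (α A)) (X : RawSet n k) (g : Fn n) →
    Covers A σ (proj₁ s) X → Below g X → Below (lift g) (proj₁ s)
  covers⇒below-lift s X g covers below ℓ j sℓj =
    succ⇒lift-≤ g ℓ (toℕ j) (λ ℓ∈α → Qk-even s ℓ∈α sℓj) λ ℓ' ℓ'∈δ →
      let (j' , j'≤j , Xℓ'j') = covers ℓ j sℓj ℓ' ℓ'∈δ in ≤∞-trans {g ℓ'} (below ℓ' j' Xℓ'j') j'≤j

module _ {n m} (A : NBW n m) (σ : Fin m) (f g : Fn n) where

  private
    FO FS : Fn n
    FO = fo A σ f g
    FS = fs A σ f g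

  Ranked : Set
  Ranked = ∃ λ ℓ → FO ℓ ≤∞ fin (K A)

  LPre-any : ∀ {P : Pair n → Set} → Any P (LPre A σ f g) ⇔ (P (FO , f∅) ⊎ (Ranked × P (FS , FO)))
  LPre-any {P} with any? (λ ℓ → FO ℓ ≤∞? fin (K A))
  ... | yes ranked = mk⇔ (λ { (here p) → inj₁ p ; (there (here p)) → inj₂ (ranked , p) })
                         (λ { (inj₁ p) → here p ; (inj₂ (_ , p)) → there (here p) })
  ... | no unranked = mk⇔ (λ { (here p) → inj₁ p })
                          (λ { (inj₁ p) → here p ; (inj₂ (ranked , _)) → contradiction ranked unranked })

  LPre-all : ∀ {P : Pair n → Set} → P (FO , f∅) → (Ranked → P (FS , FO)) → All P (LPre A σ f g)
  LPre-all p q with any? (λ ℓ → FO ℓ ≤∞? fin (K A))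
  ... | yes ranked = p ∷ q ranked ∷ []
  ... | no _ = p ∷ []

module Predecessor {n m} (A : NBW n m) (σ : Fin m) (s' o' : KStateComp A)
                   (s'≤o' : FnLe (K A) (fOf s') (fOf o')) where

  open Successors A σ

  k : ℕ
  k = K A

  -- f_{s'}, f_{o'}, h, and the components f_o = lift h, f_s = lift f_{s'} of L_Pre.
  FA FB H FO FS : Fn n
  FA = fOf s'
  FB = fOf o'
  H = h A σ FA FB
  FO = fo A σ FA FB
  FS = fs A σ FA FB

  -- k = 2(|Q| - |α|) is even, so k itself is an admissible rank of any state.
  k-even : ¬ Odd k
  k-even odd = odd (divides (n ∸ ∣ α A ∣) (*-comm 2 (n ∸ ∣ α A ∣)))

  H-cases : ∀ ℓ → (ℓ ∈ α A × H ℓ ≡ FB ℓ) ⊎ (ℓ ∉ α A × H ℓ ≡ min∞ (FB ℓ) ⌈ FA ℓ ⌉odd)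
  H-cases ℓ with lookup (α A) ℓ in ℓα
  ... | true = inj₁ (lookup⇒[]= ℓ (α A) ℓα , refl)
  ... | false = inj₂ ((λ ℓ∈α → contradiction (trans (sym ([]=⇒lookup ℓ∈α)) ℓα) λ ()) , refl)

  H≤FB : ∀ ℓ → H ℓ ≤∞ FB ℓ
  H≤FB ℓ with H-cases ℓ
  ... | inj₁ (_ , eq) = subst (_≤∞ FB ℓ) (sym eq) (≤∞-refl (FB ℓ))
  ... | inj₂ (_ , eq) = subst (_≤∞ FB ℓ) (sym eq) (min-≤ˡ (FB ℓ) _)

  FA≤[]H : ∀ ℓ → FA ℓ ≤[ k ] H ℓ
  FA≤[]H ℓ with H-cases ℓ
  ... | inj₁ (_ , eq) rewrite eq = s'≤o' ℓ
  ... | inj₂ (_ , eq) rewrite eq = min-≤[] k (FA ℓ) (FB ℓ) _ (s'≤o' ℓ) (⌈⌉odd-≥ (FA ℓ))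

  -- Admissible ranks of the canonical successors: S⁺ for s, O₂⁺ for the
  -- intermediate o₂, and O₃⁺ = O₂⁺ ∖ odd for o.
  SRank O₂Rank O₃Rank : Fin n → ℕ → Set
  SRank ℓ c = FA ℓ ≤∞ fin c × (Odd c → ℓ ∉ α A)
  O₂Rank ℓ c = (¬ Odd c → FB ℓ ≤∞ fin c) × (Odd c → ℓ ∉ α A × FA ℓ ≤∞ fin c)
  O₃Rank ℓ c = ¬ Odd c × FB ℓ ≤∞ fin c

  odd? : ∀ c → Dec (Odd c)
  odd? c = ¬? (2 ∣? c)

  ∉α? : ∀ ℓ → Dec (ℓ ∉ α A)
  ∉α? ℓ = ¬? (ℓ ∈? α A)

  module S⁺ = Tabulate {k = k} {α = α A} SRank
    (λ ℓ c → (FA ℓ ≤∞? fin c) ×-dec (odd? c →-dec ∉α? ℓ))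
    (λ ℓ c ℓ∈α odd (_ , ∉α) → ∉α odd ℓ∈α)
  module O₂⁺ = Tabulate {k = k} {α = α A} O₂Rank
    (λ ℓ c → (¬? (odd? c) →-dec (FB ℓ ≤∞? fin c)) ×-dec (odd? c →-dec (∉α? ℓ ×-dec (FA ℓ ≤∞? fin c))))
    (λ ℓ c ℓ∈α odd (_ , ∉α) → proj₁ (∉α odd) ℓ∈α)
  module O₃⁺ = Tabulate {k = k} {α = α A} O₃Rank
    (λ ℓ c → ¬? (odd? c) ×-dec (FB ℓ ≤∞? fin c))
    (λ ℓ c ℓ∈α odd (even , _) → even odd)

  H-below : ∀ ℓ c → O₂Rank ℓ c → H ℓ ≤∞ fin c
  H-below ℓ c (even⇒ , odd⇒) with 2 ∣? c
  ... | yes even = ≤∞-trans {H ℓ} (H≤FB ℓ) (even⇒ λ odd → odd even)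
  ... | no odd with odd⇒ odd | H-cases ℓ
  ...   | ℓ∉α , FA≤c | inj₁ (ℓ∈α , _) = contradiction ℓ∈α ℓ∉α
  ...   | _ , FA≤c | inj₂ (_ , eq) = subst (_≤∞ fin c) (sym eq)
          (≤∞-trans {min∞ (FB ℓ) _} (min-≤ʳ (FB ℓ) _) (⌈⌉odd-least (FA ℓ) c odd FA≤c))

  -- Below any bound on f_{s'} ℓ there is an S-rank (the value f_{s'} ℓ itself) ...
  S-at-FA : ∀ ℓ c → FA ℓ ≤∞ fin c → ∃ λ b → b ≤ c × SRank ℓ b
  S-at-FA ℓ c FA≤c with FA ℓ | minView (proj₁ s' ℓ)
  ... | _ | attained i s'ℓi _ = toℕ i , FA≤c , ≤-refl , λ odd ℓ∈α → Qk-even s' ℓ∈α s'ℓi odd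

  -- ... below any bound on f_{o'} ℓ there is an O₂-rank (the value f_{o'} ℓ) ...
  O₂-at-FB : ∀ ℓ c → FB ℓ ≤∞ fin c → ∃ λ b → b ≤ c × O₂Rank ℓ b
  O₂-at-FB ℓ c FB≤c with FB ℓ | minView (proj₁ o' ℓ) | s'≤o' ℓ
  ... | _ | attained i o'ℓi _ | FA≤[]FB =
    toℕ i , FB≤c , (λ _ → ≤-refl) ,
    λ odd → (λ ℓ∈α → Qk-even o' ℓ∈α o'ℓi odd) , ≤[]-below-rank FA≤[]FB ≤-refl (toℕ≤pred[n] i)

  O₂-at-⌈FA⌉odd : ∀ ℓ c → ℓ ∉ α A → ⌈ FA ℓ ⌉odd ≤∞ fin c → ∃ λ b → b ≤ c × O₂Rank ℓ b
  O₂-at-⌈FA⌉odd ℓ c ℓ∉α ⌈FA⌉≤c with ⌈ FA ℓ ⌉odd in eq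
  ... | fin b = b , ⌈FA⌉≤c , (λ even → contradiction (⌈⌉odd-odd (FA ℓ) b eq) even) ,
                λ _ → ℓ∉α , subst (FA ℓ ≤∞_) eq (⌈⌉odd-≥ (FA ℓ))

  O₂-reach : ∀ ℓ c → H ℓ ≤∞ fin c → ∃ λ b → b ≤ c × O₂Rank ℓ b
  O₂-reach ℓ c H≤c with H-cases ℓ
  ... | inj₁ (_ , eq) = O₂-at-FB ℓ c (subst (_≤∞ fin c) eq H≤c)
  ... | inj₂ (ℓ∉α , eq) with min-split (FB ℓ) ⌈ FA ℓ ⌉odd _ (subst (_≤∞ fin c) eq H≤c)
  ...   | inj₁ FB≤c = O₂-at-FB ℓ c FB≤c
  ...   | inj₂ ⌈FA⌉≤c = O₂-at-⌈FA⌉odd ℓ c ℓ∉α ⌈FA⌉≤c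

  O₂⇒S : ∀ ℓ c → c ≤ k → O₂Rank ℓ c → SRank ℓ c
  O₂⇒S ℓ c c≤k (even⇒ , odd⇒) = FA≤c , λ odd → proj₁ (odd⇒ odd)
    where
    FA≤c : FA ℓ ≤∞ fin c
    FA≤c with 2 ∣? c
    ... | yes even = ≤[]-below-rank (s'≤o' ℓ) (even⇒ λ odd → odd even) c≤k
    ... | no odd = proj₂ (odd⇒ odd)

  O₂⁺⊆S⁺ : SubsetR A σ (proj₁ O₂⁺.set) (proj₁ S⁺.set)
  O₂⁺⊆S⁺ ℓ j O₂ℓj = S⁺.member⁺ ℓ j (O₂⇒S ℓ (toℕ j) (toℕ≤pred[n] j) (O₂⁺.member⁻ ℓ j O₂ℓj))

  O₂⁺∖odd : MinusOdd A σ (proj₁ O₂⁺.set) (proj₁ O₃⁺.set)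
  O₂⁺∖odd ℓ j = from-O₃ , to-O₃
    where
    from-O₃ : proj₁ O₃⁺.set ℓ j ≡ true → proj₁ O₂⁺.set ℓ j ≡ true × ¬ Odd (toℕ j)
    from-O₃ O₃ℓj with O₃⁺.member⁻ ℓ j O₃ℓj
    ... | even , FB≤j = O₂⁺.member⁺ ℓ j ((λ _ → FB≤j) , λ odd → contradiction odd even) , even
    to-O₃ : proj₁ O₂⁺.set ℓ j ≡ true × ¬ Odd (toℕ j) → proj₁ O₃⁺.set ℓ j ≡ true
    to-O₃ (O₂ℓj , even) = O₃⁺.member⁺ ℓ j (even , proj₁ (O₂⁺.member⁻ ℓ j O₂ℓj) even)

  below-S⁺ : Below FA (proj₁ S⁺.set)
  below-S⁺ ℓ j S⁺ℓj = proj₁ (S⁺.member⁻ ℓ j S⁺ℓj)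

  below-O₂⁺ : Below FA (proj₁ O₂⁺.set)
  below-O₂⁺ ℓ j O₂ℓj = below-S⁺ ℓ j (O₂⁺⊆S⁺ ℓ j O₂ℓj)

  below-O₃⁺ : Below FB (proj₁ O₃⁺.set)
  below-O₃⁺ ℓ j O₃ℓj = proj₂ (O₃⁺.member⁻ ℓ j O₃ℓj)

  -- O₃⁺ is empty exactly when f_{o'} = f_∅ (a finite value of f_{o'} puts rank k into O₃⁺).
  FB∅⇒O₃⁺∅ : IsF∅ FB → IsF∅ (fOf O₃⁺.set)
  FB∅⇒O₃⁺∅ FB∅ = Vacant⇒F∅ O₃⁺.set vacant
    where
    vacant : Vacant (proj₁ O₃⁺.set)
    vacant ℓ j with proj₁ O₃⁺.set ℓ j in O₃ℓj
    ... | false = refl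
    ... | true = ⊥-elim (subst (_≤∞ fin (toℕ j)) (FB∅ ℓ) (below-O₃⁺ ℓ j O₃ℓj))

  O₃⁺∅⇒FB∅ : IsF∅ (fOf O₃⁺.set) → IsF∅ FB
  O₃⁺∅⇒FB∅ O₃∅ = Vacant⇒F∅ o' vacant
    where
    vacant : Vacant (proj₁ o')
    vacant ℓ j with proj₁ o' ℓ j in o'ℓj
    ... | false = refl
    ... | true = contradiction (trans (sym O₃ℓk) (F∅⇒Vacant O₃⁺.set O₃∅ ℓ (fromℕ k))) λ ()
      where
      FB≤k : FB ℓ ≤∞ fin k
      FB≤k = ≤∞-trans {FB ℓ} (fOf-below o' ℓ j o'ℓj) (toℕ≤pred[n] j)
      O₃ℓk : proj₁ O₃⁺.set ℓ (fromℕ k) ≡ true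
      O₃ℓk = O₃⁺.member⁺ ℓ (fromℕ k)
        (subst (λ c → ¬ Odd c × FB ℓ ≤∞ fin c) (sym (toℕ-fromℕ k)) (k-even , FB≤k))

  T : KState A → Set
  T = ⟦_⟧ {A = A} (FA , FB)

  target : (X : Qk n k (α A)) → Below FA (proj₁ X) → T (X , O₃⁺.set)
  target X below-X = Below⇒FnLe X FA below-X , Below⇒FnLe O₃⁺.set FB below-O₃⁺ , FB∅⇒O₃⁺∅ , O₃⁺∅⇒FB∅

  covers-S⁺ : (s : RawSet n k) → Below (lift FA) s → Covers A σ s (proj₁ S⁺.set)
  covers-S⁺ s = below-lift⇒covers s _ FA λ ℓ j FA≤j → S⁺.reach ℓ j (S-at-FA ℓ (toℕ j) FA≤j)

  covers-O₂⁺ : (s : RawSet n k) → Below (lift H) s → Covers A σ s (proj₁ O₂⁺.set)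
  covers-O₂⁺ s = below-lift⇒covers s _ H λ ℓ j H≤j → O₂⁺.reach ℓ j (O₂-reach ℓ (toℕ j) H≤j)

  sound-vacant : ∀ x → ⟦_⟧ {A = A} (FO , f∅) x → Pre A σ T x
  sound-vacant (s , o) (FO≤s , _ , f∅⇒o∅ , _) =
    (O₂⁺.set , O₃⁺.set) , target O₂⁺.set below-O₂⁺ ,
    inj₂ (F∅⇒Vacant o (f∅⇒o∅ λ _ → refl) , covers-O₂⁺ (proj₁ s) (FnLe⇒Below s FO FO≤s) , O₂⁺∖odd)

  sound-occupied : ∀ x → Ranked A σ FA FB → ⟦_⟧ {A = A} (FS , FO) x → Pre A σ T x
  sound-occupied (s , o) (ℓ , FOℓ≤k) (FS≤s , FO≤o , _ , o∅⇒FO∅) =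
    (S⁺.set , O₃⁺.set) , target S⁺.set below-S⁺ ,
    inj₁ ( o-occupied , O₂⁺.set , O₂⁺⊆S⁺
         , covers-S⁺ (proj₁ s) (FnLe⇒Below s FS FS≤s) , covers-O₂⁺ (proj₁ o) (FnLe⇒Below o FO FO≤o)
         , O₂⁺∖odd)
    where
    -- f_o is finite at ℓ, hence so is f_o of the pair, so o has a rank.
    o-occupied : ¬ Vacant (proj₁ o)
    o-occupied vacant = subst (_≤∞ fin k) (o∅⇒FO∅ (Vacant⇒F∅ o vacant) ℓ) FOℓ≤k

  -- Completeness: in a σ-step into T, every o₂ consists of O₂-ranks, so h bounds it.
  below-H : (o₂ : Qk n k (α A)) (s₃ o₃ : RawSet n k) →
    SubsetR A σ (proj₁ o₂) s₃ → MinusOdd A σ (proj₁ o₂) o₃ → Below FA s₃ → Below FB o₃ → Below H (proj₁ o₂)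
  below-H o₂ s₃ o₃ o₂⊆s₃ o₂∖odd below-s₃ below-o₃ ℓ j o₂ℓj = H-below ℓ (toℕ j)
    ( (λ even → below-o₃ ℓ j (proj₂ (o₂∖odd ℓ j) (o₂ℓj , even)))
    , λ odd → (λ ℓ∈α → Qk-even o₂ ℓ∈α o₂ℓj odd) , below-s₃ ℓ j (o₂⊆s₃ ℓ j o₂ℓj))

  -- Completeness when o is vacant: then o₂ = s₃, and f_o bounds s.
  complete-vacant : (s o s₃ o₃ : Qk n k (α A)) → T (s₃ , o₃) → Vacant (proj₁ o) →
    Covers A σ (proj₁ s) (proj₁ s₃) → MinusOdd A σ (proj₁ s₃) (proj₁ o₃) → ⟦_⟧ {A = A} (FO , f∅) (s , o)
  complete-vacant s o s₃ o₃ (FA≤s₃ , FB≤o₃ , _) o-vacant covers s₃∖odd =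
    Below⇒FnLe s FO below-s , (λ ℓ → inj₁ (subst (∞ ≤∞_) (sym (o∅ ℓ)) tt)) , (λ _ → o∅) , (λ _ _ → refl)
    where
    o∅ : IsF∅ (fOf o)
    o∅ = Vacant⇒F∅ o o-vacant
    below-s : Below FO (proj₁ s)
    below-s = covers⇒below-lift s _ H covers
      (below-H s₃ _ _ (λ _ _ s₃ℓj → s₃ℓj) s₃∖odd (FnLe⇒Below s₃ FA FA≤s₃) (FnLe⇒Below o₃ FB FB≤o₃))

  complete-occupied : (s o s₃ o₃ o₂ : Qk n k (α A)) → T (s₃ , o₃) → ¬ Vacant (proj₁ o) →
    SubsetR A σ (proj₁ o₂) (proj₁ s₃) → Covers A σ (proj₁ s) (proj₁ s₃) → Covers A σ (proj₁ o) (proj₁ o₂) →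
    MinusOdd A σ (proj₁ o₂) (proj₁ o₃) → Ranked A σ FA FB × ⟦_⟧ {A = A} (FS , FO) (s , o)
  complete-occupied s o s₃ o₃ o₂ (FA≤s₃ , FB≤o₃ , _) o-occupied o₂⊆s₃ covers-s covers-o o₂∖odd =
    ranked , Below⇒FnLe s FS (covers⇒below-lift s _ FA covers-s below-s₃) , Below⇒FnLe o FO below-o
    , (λ FO∅ → ⊥-elim (subst (_≤∞ fin k) (FO∅ (proj₁ ranked)) (proj₂ ranked)))
    , (λ o∅ → ⊥-elim (o-occupied (F∅⇒Vacant o o∅)))
    where
    below-s₃ : Below FA (proj₁ s₃)
    below-s₃ = FnLe⇒Below s₃ FA FA≤s₃
    below-o : Below FO (proj₁ o)
    below-o = covers⇒below-lift o _ H covers-o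
      (below-H o₂ _ _ o₂⊆s₃ o₂∖odd below-s₃ (FnLe⇒Below o₃ FB FB≤o₃))
    ranked : Ranked A σ FA FB
    ranked with occupied (proj₁ o) o-occupied
    ... | ℓ , j , oℓj = ℓ , ≤∞-trans {FO ℓ} (below-o ℓ j oℓj) (toℕ≤pred[n] j)

  InLPre : KState A → Set
  InLPre x = ⟦_⟧ {A = A} (FO , f∅) x ⊎ (Ranked A σ FA FB × ⟦_⟧ {A = A} (FS , FO) x)

  sound : ∀ x → InLPre x → Pre A σ T x
  sound x (inj₁ p) = sound-vacant x p
  sound x (inj₂ (ranked , p)) = sound-occupied x ranked p

  complete : ∀ x → Pre A σ T x → InLPre x
  complete (s , o) ((s₃ , o₃) , Ty , inj₂ (o-vacant , covers , s₃∖odd)) =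
    inj₁ (complete-vacant s o s₃ o₃ Ty o-vacant covers s₃∖odd)
  complete (s , o) ((s₃ , o₃) , Ty , inj₁ (o-occupied , o₂ , o₂⊆s₃ , covers-s , covers-o , o₂∖odd)) =
    inj₂ (complete-occupied s o s₃ o₃ o₂ Ty o-occupied o₂⊆s₃ covers-s covers-o o₂∖odd)

  Invariant : Pair n → Set
  Invariant (f₁ , f₂) = FnLe k f₁ f₂ × (∀ ℓ → ℓ ∈ α A → Even∞ (f₁ ℓ) × Even∞ (f₂ ℓ))

  invariants : All Invariant (LPre A σ FA FB)
  invariants = LPre-all A σ FA FB
    ((λ _ → inj₂ tt) , λ ℓ ℓ∈α → lift-even H ℓ ℓ∈α , tt)
    (λ _ → lift-≤[] FA H FA≤[]H , λ ℓ ℓ∈α → lift-even FA ℓ ℓ∈α , lift-even H ℓ ℓ∈α)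

theorem5p4 : ∀ {n m} (A : NBW n m) (σ : Fin m) (s' o' : KStateComp A) →
    FnLe (K A) (fOf s') (fOf o') →
    ((x : KState A) →
      ⟦_⟧L {A = A} (LPre A σ (fOf s') (fOf o')) x
        ⇔ Pre A σ (⟦_⟧ {A = A} (fOf s' , fOf o')) x)
    × All (λ p → FnLe (K A) (proj₁ p) (proj₂ p)
                 × (∀ ℓ → ℓ ∈ α A → Even∞ (proj₁ p ℓ) × Even∞ (proj₂ p ℓ)))
          (LPre A σ (fOf s') (fOf o'))
theorem5p4 A σ s' o' s'≤o' = predecessors , invariants
  where
  open Predecessor A σ s' o' s'≤o'
  predecessors : (x : KState A) → ⟦_⟧L {A = A} (LPre A σ FA FB) x ⇔ Pre A σ T x
  predecessors x = mk⇔ (sound x ∘ Equivalence.to (LPre-any A σ FA FB))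
                       (Equivalence.from (LPre-any A σ FA FB) ∘ complete x)
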